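{- For all positive integers $n\ge 2$ and $r>s$, $R'(n;r,s)=A_{n-1}(r,s)+1$. Equivalently, the maximum $N$ for which there exists an $(r,s)$-coloring of $K_N$ in which, for every color $i\in[r]$, the graph of edges whose color set contains $i$ is $(n-1)$-partite, equals the maximum size of a $q$-ary code with $q=n-1$, length $r$ and distance $s$.
   Context: An $(r,s)$-coloring of $K_N$ is a map $\chi:E(K_N)\to\binom{[r]}{s}$. For color $i$, the color class of $i$ is the graph on $V(K_N)$ whose edges are those $e$ with $i\in\chi(e)$. $R'(n;r,s)$ is the minimum $N$ such that in every $(r,s)$-coloring of $K_N$ there is a color $i$ whose color class has chromatic number at least $n$. For positive integers $q,m,d$, $A_q(m,d)$ is the maximum size of a code $C\subseteq[q]^m$ in which any two distinct codewords differ in at least $d$ coordinates (a $q$-ary code of length $m$ and distance $d$). -}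

module Defs where

open import Data.Nat using (ℕ; _≤_; _<_; suc)
open import Data.Fin using (Fin)
open import Data.Fin.Properties using (_≟_)
open import Data.Fin.Subset using (Subset; _∈_; ∣_∣)
open import Data.List using (length; filter; allFin)
open import Data.Product using (Σ; _×_)
open import Relation.Binary.PropositionalEquality using (_≡_; _≢_)
open import Relation.Nullary using (¬_)
open import Relation.Nullary.Decidable using (¬?)

hamming : {q m : ℕ} → (Fin m → Fin q) → (Fin m → Fin q) → ℕ
hamming {q} {m} x y = length (filter (λ j → ¬? (x j ≟ y j)) (allFin m))

-- a q-ary code of length m, distance d, with M codewords (indexed by Fin M;
-- distinct indices give distinct codewords since they differ in ≥ d coordinates)
Code : (q m d M : ℕ) → Set
Code q m d M = Σ (Fin M → (Fin m → Fin q)) λ c →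
  ∀ i j → i ≢ j → d ≤ hamming (c i) (c j)

IsA : (q m d M : ℕ) → Set
IsA q m d M = Code q m d M × (∀ M′ → Code q m d M′ → M′ ≤ M)

-- an (r,s)-coloring of K_N: vertices Fin N, each edge {u,v} (u ≠ v) gets an
-- s-element subset of [r]; represented by a symmetric function on ordered pairs
-- (values on the diagonal are irrelevant)
record Coloring (N r s : ℕ) : Set where
  field
    χ    : Fin N → Fin N → Subset r
    symm : ∀ u v → χ u v ≡ χ v u
    size : ∀ u v → u ≢ v → ∣ χ u v ∣ ≡ s

open Coloring public

ClassColorable : {N r s : ℕ} → Coloring N r s → Fin r → ℕ → Set
ClassColorable {N} c i k = Σ (Fin N → Fin k) λ f →
  ∀ u v → u ≢ v → i ∈ χ c u v → f u ≢ f v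

ClassChromaticAtLeast : {N r s : ℕ} → Coloring N r s → Fin r → ℕ → Set
ClassChromaticAtLeast c i n = ∀ k → k < n → ¬ ClassColorable c i k

RamseyProp : (n r s N : ℕ) → Set
RamseyProp n r s N = (c : Coloring N r s) → Σ (Fin r) λ i → ClassChromaticAtLeast c i n

IsR′ : (n r s N : ℕ) → Set
IsR′ n r s N = RamseyProp n r s N × (∀ N′ → RamseyProp n r s N′ → N ≤ N′)

-- An (r,s)-coloring of K_N all of whose color classes are q-colorable is the same thing as a
-- q-ary code of length r, size N and distance s.  Given proper colorings f₁,…,f_r of the
-- classes, the word of a vertex u is (f₁ u,…,f_r u): the s colors of an edge uv all separate
-- u from v, so the words of u and v differ in at least s coordinates.  Conversely, coloring
-- each edge uv by s coordinates where the words of u and v differ makes coordinate i a proper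
-- q-coloring of class i.  Hence every coloring of K_N with N > A_q(r,s) has a class of
-- chromatic number ≥ q + 1, while a code of size A_q(r,s) yields a coloring without one.
-- Constructively, A_q(r,s) exists because codes have at most q^r words and their existence
-- is decidable by exhaustive search.
module Submission where

open import Defs
open import Data.Nat using (ℕ; zero; suc; _≤_; _<_; _∸_; _^_; s≤s; _≤?_; _<?_)
open import Data.Nat.Properties
  using (≤-trans; ≤∧≢⇒<; <⇒≤pred; ≮⇒≥; n<1+n; 1+n≰n; module ≤-Reasoning)
open import Data.Bool using (true; false)
open import Data.Fin using (Fin; zero; suc; inject≤; funToFin; finToFun)
open import Data.Fin.Properties
  using (_≟_; any?; all?; ¬∀⟶∃¬; injective⇒≤; inject≤-injective; finToFun-funToFin)
open import Data.Fin.Subset using (Subset; inside; outside; ⊥; _∈_; _⊆_; ∣_∣)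
open import Data.Fin.Subset.Properties
  using (_∈?_; ⊆-min; out⊆; in⊆in; ∣⊥∣≡0; Empty-unique; p⊆q⇒∣p∣≤∣q∣)
open import Data.List as List using (filter)
open import Data.Product using (Σ; ∃; _×_; _,_; proj₁; proj₂; map₂)
open import Data.Vec using ([]; _∷_; tabulate)
open import Data.Vec.Properties using (lookup∘tabulate; lookup⇒[]=; []=⇒lookup; tabulate-cong)
open import Function using (_∘_)
open import Relation.Binary.PropositionalEquality
  using (_≡_; _≢_; _≗_; refl; sym; trans; cong; cong₂; subst; module ≡-Reasoning)
open import Relation.Nullary using (¬_; Dec; yes; no; does; contradiction)
open import Relation.Nullary.Decidable using (¬?; map′; _→-dec_)
open import Relation.Unary using (Pred; Decidable)

private
  variable
    q m d r s M N : ℕ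

length-filter-tabulate : ∀ {a p} {A : Set a} {P : Pred A p} (P? : Decidable P) (f : Fin m → A) →
  List.length (filter P? (List.tabulate f)) ≡ ∣ tabulate (does ∘ P? ∘ f) ∣
length-filter-tabulate {zero}  P? f = refl
length-filter-tabulate {suc m} P? f with does (P? (f zero))
... | true  = cong suc (length-filter-tabulate P? (f ∘ suc))
... | false = length-filter-tabulate P? (f ∘ suc)

disagreements : (Fin m → Fin q) → (Fin m → Fin q) → Subset m
disagreements x y = tabulate λ j → does (¬? (x j ≟ y j))

hamming≡∣disagreements∣ : (x y : Fin m → Fin q) → hamming x y ≡ ∣ disagreements x y ∣
hamming≡∣disagreements∣ x y = length-filter-tabulate (λ j → ¬? (x j ≟ y j)) (λ j → j)

∈-disagreements⁺ : (x y : Fin m → Fin q) (j : Fin m) → x j ≢ y j → j ∈ disagreements x y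
∈-disagreements⁺ x y j x≢y = lookup⇒[]= j _ (trans (lookup∘tabulate _ j) (helper (x j ≟ y j)))
  where
  helper : (x≟y : Dec (x j ≡ y j)) → does (¬? x≟y) ≡ inside
  helper (yes x≡y) = contradiction x≡y x≢y
  helper (no  _)   = refl

∈-disagreements⁻ : (x y : Fin m → Fin q) (j : Fin m) → j ∈ disagreements x y → x j ≢ y j
∈-disagreements⁻ x y j j∈ = helper (x j ≟ y j) (trans (sym (lookup∘tabulate _ j)) ([]=⇒lookup j∈))
  where
  helper : (x≟y : Dec (x j ≡ y j)) → does (¬? x≟y) ≡ inside → x j ≢ y j
  helper (no x≢y) _ = x≢y

disagreements-comm : (x y : Fin m → Fin q) → disagreements x y ≡ disagreements y x
disagreements-comm x y = tabulate-cong λ j → helper (x j ≟ y j) (y j ≟ x j)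
  where
  helper : ∀ {a b : Fin q} (a≟b : Dec (a ≡ b)) (b≟a : Dec (b ≡ a)) → does (¬? a≟b) ≡ does (¬? b≟a)
  helper (yes _)   (yes _)   = refl
  helper (no  _)   (no  _)   = refl
  helper (yes a≡b) (no  b≢a) = contradiction (sym a≡b) b≢a
  helper (no  a≢b) (yes b≡a) = contradiction (sym b≡a) a≢b

hamming-cong : {x x′ y y′ : Fin m → Fin q} → x ≗ x′ → y ≗ y′ → hamming x y ≡ hamming x′ y′
hamming-cong {x = x} {x′} {y} {y′} x≗x′ y≗y′ = begin
  hamming x y                  ≡⟨ hamming≡∣disagreements∣ x y ⟩
  ∣ disagreements x y ∣        ≡⟨ cong ∣_∣ (tabulate-cong λ j →
                                    cong₂ (λ a b → does (¬? (a ≟ b))) (x≗x′ j) (y≗y′ j)) ⟩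
  ∣ disagreements x′ y′ ∣      ≡⟨ sym (hamming≡∣disagreements∣ x′ y′) ⟩
  hamming x′ y′                ∎
  where open ≡-Reasoning

≗⇒hamming≡0 : {x y : Fin m → Fin q} → x ≗ y → hamming x y ≡ 0
≗⇒hamming≡0 {m = m} {x = x} {y} x≗y = begin
  hamming x y              ≡⟨ hamming≡∣disagreements∣ x y ⟩
  ∣ disagreements x y ∣    ≡⟨ cong ∣_∣ (Empty-unique {p = disagreements x y} λ (j , j∈) →
                                ∈-disagreements⁻ x y j j∈ (x≗y j)) ⟩
  ∣ ⊥ {m} ∣                ≡⟨ ∣⊥∣≡0 m ⟩
  0                        ∎
  where open ≡-Reasoning

lowest : ℕ → Subset m → Subset m
lowest zero    p             = ⊥
lowest (suc k) []            = []
lowest (suc k) (outside ∷ p) = outside ∷ lowest (suc k) p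
lowest (suc k) (inside  ∷ p) = inside ∷ lowest k p

lowest-⊆ : ∀ k (p : Subset m) → lowest k p ⊆ p
lowest-⊆ zero    p             = ⊆-min p
lowest-⊆ (suc k) []            = λ ()
lowest-⊆ (suc k) (outside ∷ p) = out⊆ (lowest-⊆ (suc k) p)
lowest-⊆ (suc k) (inside  ∷ p) = in⊆in (lowest-⊆ k p)

∣lowest∣≡k : ∀ k (p : Subset m) → k ≤ ∣ p ∣ → ∣ lowest k p ∣ ≡ k
∣lowest∣≡k {m} zero    p             _         = ∣⊥∣≡0 m
∣lowest∣≡k     (suc k) (outside ∷ p) k<∣p∣     = ∣lowest∣≡k (suc k) p k<∣p∣
∣lowest∣≡k     (suc k) (inside  ∷ p) (s≤s k≤) = cong suc (∣lowest∣≡k k p k≤)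

funToFin-injective : (f g : Fin m → Fin q) → funToFin f ≡ funToFin g → f ≗ g
funToFin-injective f g eq j = begin
  f j                       ≡⟨ finToFun-funToFin f j ⟨
  finToFun (funToFin f) j   ≡⟨ cong (λ k → finToFun k j) eq ⟩
  finToFun (funToFin g) j   ≡⟨ finToFun-funToFin g j ⟩
  g j                       ∎
  where open ≡-Reasoning

any?-→ : ∀ {p} {P : Pred (Fin m → Fin q) p} → (∀ {f g} → f ≗ g → P f → P g) →
  Decidable P → Dec (∃ P)
any?-→ resp P? = map′ (λ (k , Pk) → finToFun k , Pk)
  (λ (f , Pf) → funToFin f , resp (sym ∘ finToFun-funToFin f) Pf)
  (any? (P? ∘ finToFun))

bounded-max : ∀ {p} {P : Pred ℕ p} → Decidable P → P 0 → ∀ k → (∀ n → P n → n ≤ k) →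
  ∃ λ M → P M × (∀ n → P n → n ≤ M)
bounded-max P? P0 zero    ≤k = 0 , P0 , ≤k
bounded-max P? P0 (suc k) ≤k with P? (suc k)
... | yes Pk = suc k , Pk , ≤k
... | no ¬Pk = bounded-max P? P0 k λ n Pn → <⇒≤pred (≤∧≢⇒< (≤k n Pn) λ { refl → ¬Pk Pn })

Code-restrict : N ≤ M → Code q m d M → Code q m d N
Code-restrict N≤M (c , dist) =
  c ∘ (λ i → inject≤ i N≤M) , λ i j i≢j → dist _ _ (i≢j ∘ inject≤-injective N≤M N≤M i j)

code-size≤ : 0 < d → Code q m d M → M ≤ q ^ m
code-size≤ {d = d} 0<d (c , dist) = injective⇒≤ {f = funToFin ∘ c} injective
  where
  injective : ∀ {i j} → funToFin (c i) ≡ funToFin (c j) → i ≡ j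
  injective {i} {j} eq with i ≟ j
  ... | yes i≡j = i≡j
  ... | no  i≢j = contradiction
        (≤-trans 0<d (subst (d ≤_) (≗⇒hamming≡0 (funToFin-injective (c i) (c j) eq)) (dist i j i≢j)))
        λ ()

code? : ∀ q m d M → Dec (Code q m d M)
code? q m d M = map′ (λ (w , dist) → word ∘ w , dist)
  (λ (c , dist) → funToFin ∘ c , λ i j i≢j →
    subst (d ≤_) (hamming-cong (sym ∘ finToFun-funToFin (c i)) (sym ∘ finToFun-funToFin (c j)))
      (dist i j i≢j))
  (any?-→ resp λ w → all? λ i → all? λ j → ¬? (i ≟ j) →-dec d ≤? hamming (word (w i)) (word (w j)))
  where
  word : Fin (q ^ m) → Fin m → Fin q
  word = finToFun
  resp : ∀ {w w′ : Fin M → Fin (q ^ m)} → w ≗ w′ →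
    (∀ i j → i ≢ j → d ≤ hamming (word (w i)) (word (w j))) →
    (∀ i j → i ≢ j → d ≤ hamming (word (w′ i)) (word (w′ j)))
  resp w≗w′ dist i j i≢j =
    subst (λ (a , b) → d ≤ hamming (word a) (word b)) (cong₂ _,_ (w≗w′ i) (w≗w′ j)) (dist i j i≢j)

A-exists : 0 < d → ∃ λ M → IsA q m d M
A-exists {d} {q} {m} 0<d = bounded-max (code? q m d) ((λ ()) , λ ()) (q ^ m) λ M → code-size≤ 0<d

code⇒coloring : Code q r s N → Σ (Coloring N r s) λ col → ∀ i → ClassColorable col i q
code⇒coloring {q} {r} {s} {N} (c , dist) = col , λ i → (λ u → c u i) , λ u v _ i∈ →
  ∈-disagreements⁻ (c u) (c v) i (lowest-⊆ s (disagreements (c u) (c v)) i∈)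
  where
  -- Any s coordinates where c u and c v differ would do; taking the s lowest makes χ symmetric.
  col : Coloring N r s
  col = record
    { χ    = λ u v → lowest s (disagreements (c u) (c v))
    ; symm = λ u v → cong (lowest s) (disagreements-comm (c u) (c v))
    ; size = λ u v u≢v → ∣lowest∣≡k s _
        (subst (s ≤_) (hamming≡∣disagreements∣ (c u) (c v)) (dist u v u≢v))
    }

coloring⇒code : (col : Coloring N r s) → (∀ i → ClassColorable col i q) → Code q r s N
coloring⇒code {N} {r} {s} {q} col colorable = word , λ u v u≢v → begin
  s                                   ≡⟨ size col u v u≢v ⟨
  ∣ χ col u v ∣                       ≤⟨ p⊆q⇒∣p∣≤∣q∣ (χ⊆disagreements u v u≢v) ⟩
  ∣ disagreements (word u) (word v) ∣ ≡⟨ hamming≡∣disagreements∣ (word u) (word v) ⟨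
  hamming (word u) (word v)           ∎
  where
  open ≤-Reasoning
  word : Fin N → Fin r → Fin q
  word u i = proj₁ (colorable i) u
  χ⊆disagreements : ∀ u v → u ≢ v → χ col u v ⊆ disagreements (word u) (word v)
  χ⊆disagreements u v u≢v {i} i∈ =
    ∈-disagreements⁺ (word u) (word v) i (proj₂ (colorable i) u v u≢v i∈)

classColorable? : (col : Coloring N r s) (i : Fin r) (k : ℕ) → Dec (ClassColorable col i k)
classColorable? col i k = any?-→ resp λ f →
  all? λ u → all? λ v → ¬? (u ≟ v) →-dec (i ∈? χ col u v) →-dec ¬? (f u ≟ f v)
  where
  resp : ∀ {f g} → f ≗ g → (∀ u v → u ≢ v → i ∈ χ col u v → f u ≢ f v) →
    ∀ u v → u ≢ v → i ∈ χ col u v → g u ≢ g v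
  resp f≗g proper u v u≢v i∈ gu≡gv = proper u v u≢v i∈ (trans (f≗g u) (trans gu≡gv (sym (f≗g v))))

¬colorable⇒chromatic≥ : {col : Coloring N r s} {i : Fin r} →
  ¬ ClassColorable col i q → ClassChromaticAtLeast col i (suc q)
¬colorable⇒chromatic≥ ¬colorable k (s≤s k≤q) (f , proper) =
  ¬colorable ((λ u → inject≤ (f u) k≤q) , λ u v u≢v i∈ → proper u v u≢v i∈ ∘ inject≤-injective k≤q k≤q _ _)

ramsey-above-A : IsA q r s M → RamseyProp (suc q) r s (suc M)
ramsey-above-A {q} {r} (_ , maximal) col with all? (λ i → classColorable? col i q)
... | yes colorable  = contradiction (maximal _ (coloring⇒code col colorable)) 1+n≰n
... | no ¬colorable  =
  map₂ (¬colorable⇒chromatic≥ {col = col}) (¬∀⟶∃¬ r _ (λ i → classColorable? col i q) ¬colorable)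

code⇒¬ramsey : Code q r s N → ¬ RamseyProp (suc q) r s N
code⇒¬ramsey {q} code ramsey =
  let col , colorable = code⇒coloring code
      i , chromatic≥  = ramsey col
  in chromatic≥ q (n<1+n q) (colorable i)

ramsey⇒A< : IsA q r s M → RamseyProp (suc q) r s N → M < N
ramsey⇒A< {M = M} {N} (code , _) ramsey with M <? N
... | yes M<N = M<N
... | no  M≮N = contradiction ramsey (code⇒¬ramsey (Code-restrict (≮⇒≥ M≮N) code))

theorem4p2 : (n r s : ℕ) → 2 ≤ n → 1 ≤ s → s < r →
    Σ ℕ λ M → IsA (n ∸ 1) r s M × IsR′ n r s (suc M)
theorem4p2 (suc q) r s _ 0<s _ with M , isA ← A-exists {q = q} {r} 0<s
  = M , isA , ramsey-above-A isA , λ _ → ramsey⇒A< isA
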